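{- For every integer $k\geq 3$, $\mathcal{S}_3(2,k)$ contains every integer $m\geq 6$ with $m\neq 7$; that is, $\mathbb{N}\setminus\{1,2,3,4,5,7\}\subseteq\mathcal{S}_3(2,k)$.
   Context: Let $V$ be a set of $v$ elements and let $k,t$ be positive integers with $t<k<v$. A block is a $k$-subset of $V$. A $\mu$-way $(v,k,t)$ trade of volume $m$ is a family $T=\{T_1,\dots,T_\mu\}$ of $\mu$ pairwise disjoint collections of blocks, each $T_i$ consisting of exactly $m$ blocks, such that for every $t$-subset $S$ of $V$, the number of blocks of $T_i$ containing $S$ is the same for all $i$. $\mathcal{S}_\mu(t,k)$ denotes the set of all positive integers $m$ such that a $\mu$-way $(v,k,t)$ trade of volume $m$ exists for some $v$. Here $\mathbb{N}=\{1,2,3,\dots\}$. -}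

module Defs where

open import Data.Nat using (ℕ; _<_)
open import Data.Fin using (Fin)
open import Data.Fin.Subset using (Subset; _⊆_; ∣_∣)
open import Data.Fin.Subset.Properties using (_⊆?_)
open import Data.List using (List; length; filter)
open import Data.List.Relation.Unary.All using (All)
open import Data.List.Relation.Unary.Unique.Propositional using (Unique)
open import Data.List.Membership.Propositional using (_∈_)
open import Data.Product using (Σ; _×_; ∃)
open import Relation.Binary.PropositionalEquality using (_≡_; _≢_)
open import Relation.Nullary using (¬_)

IsBlock : {v : ℕ} → ℕ → Subset v → Set
IsBlock k B = ∣ B ∣ ≡ k

λcount : {v : ℕ} → Subset v → List (Subset v) → ℕ
λcount S C = length (filter (S ⊆?_) C)

record IsTrade (μ v k t m : ℕ) (T : Fin μ → List (Subset v)) : Set where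
  field
    blocks    : ∀ i → All (IsBlock k) (T i)
    distinct  : ∀ i → Unique (T i)
    volume    : ∀ i → length (T i) ≡ m
    disjoint  : ∀ i j → i ≢ j → ∀ B → B ∈ T i → ¬ (B ∈ T j)
    balanced  : ∀ (S : Subset v) → ∣ S ∣ ≡ t →
                ∀ i j → λcount S (T i) ≡ λcount S (T j)

-- m ∈ 𝒮_μ(t,k): a μ-way (v,k,t) trade of volume m exists for some v
-- (with t < k < v, the standing assumption).
InS : (μ t k m : ℕ) → Set
InS μ t k m = Σ ℕ λ v → t < k × k < v ×
                (Σ (Fin μ → List (Subset v)) λ T → IsTrade μ v k t m T)

module Submission where

-- Three-way (v,3,2) trades of volumes 6, 8, 9, 10, 11 and 13 exist on at most nine points.
-- Trades on disjoint point sets combine into a trade whose volume is the sum, so every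
-- m ≥ 6 with m ≠ 7 is reached (12 = 6 + 6, and m + 6 from m).  Adjoining j new points to
-- every block turns a (v,k,t) trade into a (v+j,k+j,t) trade of the same volume, which
-- lifts the result from k = 3 to every k ≥ 3.

open import Defs
open import Data.Bool using (Bool; true; false; _∧_; if_then_else_)
import Data.Bool.Properties as Bool
open import Data.Fin using (Fin; zero; suc; #_)
import Data.Fin.Properties as Fin
open import Data.Fin.Subset using (Subset; ∣_∣; ⊥; ⊤; ⁅_⁆; _∪_)
open import Data.Fin.Subset.Properties using (_⊆?_; anySubset?; ∣⊥∣≡0; ∣⊤∣≡n)
open import Data.Empty using (⊥-elim)
open import Data.List using (List; []; _∷_; length; filter; map) renaming (_++_ to _++ₗ_)
open import Data.List.Properties using (length-++; length-map; filter-++)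
open import Data.List.Relation.Unary.All as All using (All)
import Data.List.Relation.Unary.All.Properties as All
open import Data.List.Relation.Unary.Unique.Propositional using (Unique)
import Data.List.Relation.Unary.Unique.Propositional.Properties as Unique
import Data.List.Relation.Unary.Unique.DecPropositional as DecUnique
open import Data.List.Membership.Propositional using (_∈_; _∉_)
open import Data.List.Membership.Propositional.Properties using (∈-map⁻; ∈-++⁻)
import Data.List.Membership.DecPropositional as DecMembership
open import Data.Nat using (ℕ; suc; _+_; _≤_; _<_; _≤?_; z≤n; s≤s)
import Data.Nat as ℕ
open import Data.Nat.Properties using (≤-reflexive; ≤-trans; m≤m+n; m≤n+m; +-monoˡ-<; +-identityʳ; m≤n⇒∃[o]m+o≡n)
open import Data.Product using (Σ; _×_; _,_; proj₁)
open import Data.Sum using (inj₁; inj₂)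
open import Data.Vec using (_∷_; []; _++_; splitAt)
open import Data.Vec.Properties using (++-injectiveˡ; ++-injectiveʳ; ≡-dec)
open import Level using (Level)
open import Relation.Binary.PropositionalEquality using (_≡_; _≢_; refl; sym; trans; cong; cong₂; subst)
open import Relation.Nullary using (¬_; Dec; does; ¬?)
open import Relation.Nullary.Decidable using (True; _×-dec_; _→-dec_; map′; from-yes; decidable-stable)
open import Relation.Unary using (Pred; Decidable)

private
  variable
    ℓ : Level
    μ a b v j k t m n : ℕ

∣p++q∣≡∣p∣+∣q∣ : (p : Subset a) (q : Subset b) → ∣ p ++ q ∣ ≡ ∣ p ∣ + ∣ q ∣
∣p++q∣≡∣p∣+∣q∣ []          q = refl
∣p++q∣≡∣p∣+∣q∣ (true  ∷ p) q = cong suc (∣p++q∣≡∣p∣+∣q∣ p q)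
∣p++q∣≡∣p∣+∣q∣ (false ∷ p) q = ∣p++q∣≡∣p∣+∣q∣ p q

∣p++q∣≤t⇒∣p∣≤t×∣q∣≤t : (p : Subset a) (q : Subset b) → ∣ p ++ q ∣ ≤ t → ∣ p ∣ ≤ t × ∣ q ∣ ≤ t
∣p++q∣≤t⇒∣p∣≤t×∣q∣≤t p q ∣p++q∣≤t =
  ≤-trans (m≤m+n ∣ p ∣ ∣ q ∣) ∣p∣+∣q∣≤t , ≤-trans (m≤n+m ∣ q ∣ ∣ p ∣) ∣p∣+∣q∣≤t
  where ∣p∣+∣q∣≤t = subst (_≤ _) (∣p++q∣≡∣p∣+∣q∣ p q) ∣p++q∣≤t

++-⊆? : (p r : Subset a) (q s : Subset b) →
        does (p ++ q ⊆? r ++ s) ≡ does (p ⊆? r) ∧ does (q ⊆? s)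
++-⊆? []          []          q s = refl
++-⊆? (false ∷ p) (_     ∷ r) q s = ++-⊆? p r q s
++-⊆? (true  ∷ p) (false ∷ r) q s = refl
++-⊆? (true  ∷ p) (true  ∷ r) q s = ++-⊆? p r q s

++-elim : {P : Subset (a + b) → Set ℓ} → (∀ p q → P (p ++ q)) → ∀ S → P S
++-elim {a = a} P++ S with splitAt a S
... | p , q , refl = P++ p q

λcount-++ : (S : Subset v) (C D : List (Subset v)) → λcount S (C ++ₗ D) ≡ λcount S C + λcount S D
λcount-++ S C D = trans (cong length (filter-++ (S ⊆?_) C D)) (length-++ (filter (S ⊆?_) C))

λcount-map : (f : Subset a → Subset b) (S′ : Subset b) (S : Subset a) (c : Bool) →
             (∀ B → does (S′ ⊆? f B) ≡ c ∧ does (S ⊆? B)) →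
             ∀ C → λcount S′ (map f C) ≡ (if c then λcount S C else 0)
λcount-map f S′ S true  factor []      = refl
λcount-map f S′ S false factor []      = refl
λcount-map f S′ S true  factor (B ∷ C) rewrite factor B with does (S ⊆? B)
... | true  = cong suc (λcount-map f S′ S true factor C)
... | false = λcount-map f S′ S true factor C
λcount-map f S′ S false factor (B ∷ C) rewrite factor B = λcount-map f S′ S false factor C

λcount-map-++ʳ : (S₁ : Subset a) (S₂ Q : Subset b) (C : List (Subset a)) →
                 λcount (S₁ ++ S₂) (map (_++ Q) C) ≡ (if does (S₂ ⊆? Q) then λcount S₁ C else 0)
λcount-map-++ʳ S₁ S₂ Q = λcount-map (_++ Q) (S₁ ++ S₂) S₁ (does (S₂ ⊆? Q))
  (λ B → trans (++-⊆? S₁ B S₂ Q) (Bool.∧-comm (does (S₁ ⊆? B)) _))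

λcount-map-++ˡ : (S₁ P : Subset a) (S₂ : Subset b) (C : List (Subset b)) →
                 λcount (S₁ ++ S₂) (map (P ++_) C) ≡ (if does (S₁ ⊆? P) then λcount S₂ C else 0)
λcount-map-++ˡ S₁ P S₂ = λcount-map (P ++_) (S₁ ++ S₂) S₂ (does (S₁ ⊆? P)) (λ B → ++-⊆? S₁ P S₂ B)

module _ {f : Subset a → Subset b} (f-injective : ∀ {x y} → f x ≡ f y → x ≡ y) where

  ∈-map-injective : ∀ {x C} → f x ∈ map f C → x ∈ C
  ∈-map-injective fx∈fC with ∈-map⁻ f fx∈fC
  ... | y , y∈C , fx≡fy = subst (_∈ _) (sym (f-injective fx≡fy)) y∈C

  map-disjoint : {C D : List (Subset a)} → (∀ B → B ∈ C → B ∉ D) → ∀ B → B ∈ map f C → B ∉ map f D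
  map-disjoint C#D _ B∈fC B∈fD with ∈-map⁻ f B∈fC
  ... | x , x∈C , refl = C#D x x∈C (∈-map-injective B∈fD)

-- Padding with common points turns a t-subset of the new point set into a possibly smaller
-- subset of the old one, so the constructions carry balance on all subsets of size ≤ t.
record IsTrade≤ (μ v k t m : ℕ) (T : Fin μ → List (Subset v)) : Set where
  field
    blocks    : ∀ i → All (IsBlock k) (T i)
    distinct  : ∀ i → Unique (T i)
    volume    : ∀ i → length (T i) ≡ m
    disjoint  : ∀ i j → i ≢ j → ∀ B → B ∈ T i → ¬ (B ∈ T j)
    balanced≤ : ∀ (S : Subset v) → ∣ S ∣ ≤ t → ∀ i j → λcount S (T i) ≡ λcount S (T j)

IsTrade≤⇒IsTrade : {T : Fin μ → List (Subset v)} → IsTrade≤ μ v k t m T → IsTrade μ v k t m T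
IsTrade≤⇒IsTrade trade = record
  { blocks   = blocks
  ; distinct = distinct
  ; volume   = volume
  ; disjoint = disjoint
  ; balanced = λ S ∣S∣≡t → balanced≤ S (≤-reflexive ∣S∣≡t)
  }
  where open IsTrade≤ trade

allSubsets? : {P : Pred (Subset v) ℓ} → Decidable P → Dec (∀ S → P S)
allSubsets? P? = map′
  (λ ∄¬P S → decidable-stable (P? S) (λ ¬PS → ∄¬P (S , ¬PS)))
  (λ ∀P (S , ¬PS) → ¬PS (∀P S))
  (¬? (anySubset? (λ S → ¬? (P? S))))

isTrade≤? : ∀ k t m (T : Fin μ → List (Subset v)) → Dec (IsTrade≤ μ v k t m T)
isTrade≤? k t m T = map′
  (λ (bl , dt , vl , dj , bal) → record
    { blocks = bl ; distinct = dt ; volume = vl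
    ; disjoint = λ i j i≢j B → All.lookup (dj i j i≢j) ; balanced≤ = bal })
  (λ trade → let open IsTrade≤ trade in
    blocks , distinct , volume , (λ i j i≢j → All.tabulate (disjoint i j i≢j _)) , balanced≤)
  (  Fin.all? (λ i → All.all? (λ B → ∣ B ∣ ℕ.≟ k) (T i))
  ×-dec Fin.all? (λ i → unique? (T i))
  ×-dec Fin.all? (λ i → length (T i) ℕ.≟ m)
  ×-dec Fin.all? (λ i → Fin.all? λ j → ¬? (i Fin.≟ j) →-dec All.all? (λ B → ¬? (B ∈? T j)) (T i))
  ×-dec allSubsets? (λ S → ∣ S ∣ ≤? t →-dec
          Fin.all? λ i → Fin.all? λ j → λcount S (T i) ℕ.≟ λcount S (T j)))
  where
  open DecMembership (≡-dec Bool._≟_) using (_∈?_)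
  open DecUnique (≡-dec Bool._≟_) using (unique?)

embedˡ : Subset a → Subset (a + b)
embedˡ B = B ++ ⊥

embedʳ : Subset b → Subset (a + b)
embedʳ B = ⊥ ++ B

embedˡ-injective : {x y : Subset a} → embedˡ {b = b} x ≡ embedˡ y → x ≡ y
embedˡ-injective {x = x} {y} = ++-injectiveˡ x y

embedʳ-injective : {x y : Subset b} → embedʳ {a = a} x ≡ embedʳ y → x ≡ y
embedʳ-injective {a = a} = ++-injectiveʳ (⊥ {n = a}) ⊥

∣embedˡ∣ : (x : Subset a) → ∣ embedˡ {b = b} x ∣ ≡ ∣ x ∣
∣embedˡ∣ {b = b} x =
  trans (∣p++q∣≡∣p∣+∣q∣ x ⊥) (trans (cong (∣ x ∣ +_) (∣⊥∣≡0 b)) (+-identityʳ ∣ x ∣))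

∣embedʳ∣ : (x : Subset b) → ∣ embedʳ {a = a} x ∣ ≡ ∣ x ∣
∣embedʳ∣ {a = a} x = trans (∣p++q∣≡∣p∣+∣q∣ (⊥ {n = a}) x) (cong (_+ ∣ x ∣) (∣⊥∣≡0 a))

embedˡ≢embedʳ : {x : Subset a} {y : Subset b} → ∣ x ∣ ≡ suc k → embedˡ x ≢ embedʳ y
embedˡ≢embedʳ {a = a} {x = x} ∣x∣≡1+k x⊥≡⊥y
  with trans (sym ∣x∣≡1+k) (trans (cong ∣_∣ (++-injectiveˡ x ⊥ x⊥≡⊥y)) (∣⊥∣≡0 a))
... | ()

juxtapose : (Fin μ → List (Subset a)) → (Fin μ → List (Subset b)) → Fin μ → List (Subset (a + b))
juxtapose A B i = map embedˡ (A i) ++ₗ map embedʳ (B i)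

λcount-juxtapose : (S₁ : Subset a) (S₂ : Subset b)
                   (A : Fin μ → List (Subset a)) (B : Fin μ → List (Subset b)) →
                   ∀ i → λcount (S₁ ++ S₂) (juxtapose A B i)
                       ≡ (if does (S₂ ⊆? ⊥) then λcount S₁ (A i) else 0)
                         + (if does (S₁ ⊆? ⊥) then λcount S₂ (B i) else 0)
λcount-juxtapose S₁ S₂ A B i =
  trans (λcount-++ (S₁ ++ S₂) (map embedˡ (A i)) (map embedʳ (B i)))
        (cong₂ _+_ (λcount-map-++ʳ S₁ S₂ ⊥ (A i)) (λcount-map-++ˡ S₁ ⊥ S₂ (B i)))

IsTrade≤-juxtapose : {A : Fin μ → List (Subset a)} {B : Fin μ → List (Subset b)} →
                     IsTrade≤ μ a (suc k) t m A → IsTrade≤ μ b (suc k) t n B →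
                     IsTrade≤ μ (a + b) (suc k) t (m + n) (juxtapose A B)
IsTrade≤-juxtapose {a = a} {b = b} {A = A} {B} TA TB = record
  { blocks    = λ i → All.++⁺ (All.map⁺ (All.map (λ {x} → trans (∣embedˡ∣ {b = b} x)) (TA.blocks i)))
                              (All.map⁺ (All.map (λ {x} → trans (∣embedʳ∣ {a = a} x)) (TB.blocks i)))
  ; distinct  = λ i → Unique.++⁺ (Unique.map⁺ embedˡ-injective (TA.distinct i))
                                 (Unique.map⁺ embedʳ-injective (TB.distinct i))
                                 (λ (p , q) → left∉right i i p q)
  ; volume    = λ i → trans (length-++ (map embedˡ (A i)))
                            (cong₂ _+_ (trans (length-map embedˡ (A i)) (TA.volume i))
                                       (trans (length-map embedʳ (B i)) (TB.volume i)))
  ; disjoint  = disjoint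
  ; balanced≤ = ++-elim λ S₁ S₂ ∣S∣≤t i j →
      let ∣S₁∣≤t , ∣S₂∣≤t = ∣p++q∣≤t⇒∣p∣≤t×∣q∣≤t S₁ S₂ ∣S∣≤t in
      trans (λcount-juxtapose S₁ S₂ A B i)
     (trans (cong₂ _+_ (cong (λ c → if does (S₂ ⊆? ⊥) then c else 0)
                             (TA.balanced≤ S₁ ∣S₁∣≤t i j))
                       (cong (λ c → if does (S₁ ⊆? ⊥) then c else 0)
                             (TB.balanced≤ S₂ ∣S₂∣≤t i j)))
            (sym (λcount-juxtapose S₁ S₂ A B j)))
  }
  where
  module TA = IsTrade≤ TA
  module TB = IsTrade≤ TB

  left∉right : ∀ i j {C} → C ∈ map embedˡ (A i) → C ∉ map embedʳ (B j)
  left∉right i j C∈A C∈B with ∈-map⁻ embedˡ C∈A | ∈-map⁻ embedʳ C∈B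
  ... | x , x∈A , refl | y , _ , x⊥≡⊥y = embedˡ≢embedʳ {b = b} (All.lookup (TA.blocks i) x∈A) x⊥≡⊥y

  disjoint : ∀ i j → i ≢ j → ∀ C → C ∈ juxtapose A B i → C ∉ juxtapose A B j
  disjoint i j i≢j C C∈i C∈j with ∈-++⁻ (map embedˡ (A i)) C∈i | ∈-++⁻ (map embedˡ (A j)) C∈j
  ... | inj₁ p | inj₁ q = map-disjoint embedˡ-injective (TA.disjoint i j i≢j) C p q
  ... | inj₂ p | inj₂ q = map-disjoint embedʳ-injective (TB.disjoint i j i≢j) C p q
  ... | inj₁ p | inj₂ q = left∉right i j p q
  ... | inj₂ p | inj₁ q = left∉right j i q p

pad : (j : ℕ) → Subset v → Subset (v + j)
pad j B = B ++ ⊤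

∣pad∣ : ∀ j (x : Subset v) → ∣ pad j x ∣ ≡ ∣ x ∣ + j
∣pad∣ j x = trans (∣p++q∣≡∣p∣+∣q∣ x ⊤) (cong (∣ x ∣ +_) (∣⊤∣≡n j))

IsTrade≤-pad : {T : Fin μ → List (Subset v)} → ∀ j →
               IsTrade≤ μ v k t m T → IsTrade≤ μ (v + j) (k + j) t m (λ i → map (pad j) (T i))
IsTrade≤-pad {v = v} {T = T} j TT = record
  { blocks    = λ i → All.map⁺ (All.map (λ {x} ∣x∣≡k → trans (∣pad∣ j x) (cong (_+ j) ∣x∣≡k)) (blocks i))
  ; distinct  = λ i → Unique.map⁺ pad-injective (distinct i)
  ; volume    = λ i → trans (length-map (pad j) (T i)) (volume i)
  ; disjoint  = λ i i′ i≢i′ → map-disjoint pad-injective (disjoint i i′ i≢i′)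
  ; balanced≤ = ++-elim λ S₁ S₂ ∣S∣≤t i i′ →
      trans (λcount-map-++ʳ S₁ S₂ ⊤ (T i))
     (trans (cong (λ c → if does (S₂ ⊆? ⊤) then c else 0)
                  (balanced≤ S₁ (proj₁ (∣p++q∣≤t⇒∣p∣≤t×∣q∣≤t S₁ S₂ ∣S∣≤t)) i i′))
            (sym (λcount-map-++ʳ S₁ S₂ ⊤ (T i′))))
  }
  where
  open IsTrade≤ TT
  pad-injective : {x y : Subset v} → pad j x ≡ pad j y → x ≡ y
  pad-injective {x} {y} = ++-injectiveˡ x y

HasTrade≤ : (μ t k m : ℕ) → Set
HasTrade≤ μ t k m = Σ ℕ λ v → k < v × Σ (Fin μ → List (Subset v)) (IsTrade≤ μ v k t m)

HasTrade≤-+ : HasTrade≤ μ t (suc k) m → HasTrade≤ μ t (suc k) n → HasTrade≤ μ t (suc k) (m + n)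
HasTrade≤-+ (a , k<a , A , TA) (b , _ , B , TB) =
  a + b , ≤-trans k<a (m≤m+n a b) , juxtapose A B , IsTrade≤-juxtapose TA TB

HasTrade≤⇒InS : t < k → ∀ j → HasTrade≤ μ t k m → InS μ t (k + j) m
HasTrade≤⇒InS {k = k} t<k j (v , k<v , T , TT) =
  v + j , ≤-trans t<k (m≤m+n k j) , +-monoˡ-< j k<v , _ , IsTrade≤⇒IsTrade (IsTrade≤-pad j TT)

⟨_,_,_⟩ : ∀ x y z {x<v : True (x ℕ.<? v)} {y<v : True (y ℕ.<? v)} {z<v : True (z ℕ.<? v)} →
          Subset v
⟨ x , y , z ⟩ {x<v} {y<v} {z<v} =
  ⁅ (# x) {m<n = x<v} ⁆ ∪ ⁅ (# y) {m<n = y<v} ⁆ ∪ ⁅ (# z) {m<n = z<v} ⁆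

trade₆ : Fin 3 → List (Subset 7)
trade₆ zero =
  ⟨ 0 , 1 , 4 ⟩ ∷ ⟨ 0 , 2 , 5 ⟩ ∷ ⟨ 0 , 3 , 6 ⟩ ∷ ⟨ 1 , 2 , 6 ⟩ ∷ ⟨ 1 , 3 , 5 ⟩ ∷
  ⟨ 4 , 5 , 6 ⟩ ∷ []
trade₆ (suc zero) =
  ⟨ 0 , 1 , 3 ⟩ ∷ ⟨ 0 , 2 , 6 ⟩ ∷ ⟨ 0 , 4 , 5 ⟩ ∷ ⟨ 1 , 2 , 5 ⟩ ∷ ⟨ 1 , 4 , 6 ⟩ ∷
  ⟨ 3 , 5 , 6 ⟩ ∷ []
trade₆ (suc (suc zero)) =
  ⟨ 0 , 1 , 2 ⟩ ∷ ⟨ 0 , 3 , 5 ⟩ ∷ ⟨ 0 , 4 , 6 ⟩ ∷ ⟨ 1 , 3 , 6 ⟩ ∷ ⟨ 1 , 4 , 5 ⟩ ∷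
  ⟨ 2 , 5 , 6 ⟩ ∷ []

trade₈ : Fin 3 → List (Subset 8)
trade₈ zero =
  ⟨ 0 , 5 , 7 ⟩ ∷ ⟨ 0 , 1 , 4 ⟩ ∷ ⟨ 1 , 6 , 7 ⟩ ∷ ⟨ 3 , 4 , 5 ⟩ ∷ ⟨ 2 , 3 , 7 ⟩ ∷
  ⟨ 2 , 4 , 6 ⟩ ∷ ⟨ 1 , 2 , 5 ⟩ ∷ ⟨ 0 , 3 , 6 ⟩ ∷ []
trade₈ (suc zero) =
  ⟨ 0 , 4 , 6 ⟩ ∷ ⟨ 0 , 1 , 7 ⟩ ∷ ⟨ 3 , 6 , 7 ⟩ ∷ ⟨ 2 , 3 , 4 ⟩ ∷ ⟨ 1 , 4 , 5 ⟩ ∷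
  ⟨ 0 , 3 , 5 ⟩ ∷ ⟨ 2 , 5 , 7 ⟩ ∷ ⟨ 1 , 2 , 6 ⟩ ∷ []
trade₈ (suc (suc zero)) =
  ⟨ 3 , 4 , 6 ⟩ ∷ ⟨ 1 , 2 , 4 ⟩ ∷ ⟨ 0 , 1 , 6 ⟩ ∷ ⟨ 2 , 6 , 7 ⟩ ∷ ⟨ 2 , 3 , 5 ⟩ ∷
  ⟨ 1 , 5 , 7 ⟩ ∷ ⟨ 0 , 4 , 5 ⟩ ∷ ⟨ 0 , 3 , 7 ⟩ ∷ []

trade₉ : Fin 3 → List (Subset 9)
trade₉ zero =
  ⟨ 0 , 3 , 6 ⟩ ∷ ⟨ 0 , 4 , 7 ⟩ ∷ ⟨ 0 , 5 , 8 ⟩ ∷ ⟨ 1 , 3 , 7 ⟩ ∷ ⟨ 1 , 4 , 8 ⟩ ∷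
  ⟨ 1 , 5 , 6 ⟩ ∷ ⟨ 2 , 3 , 8 ⟩ ∷ ⟨ 2 , 4 , 6 ⟩ ∷ ⟨ 2 , 5 , 7 ⟩ ∷ []
trade₉ (suc zero) =
  ⟨ 0 , 3 , 7 ⟩ ∷ ⟨ 0 , 4 , 8 ⟩ ∷ ⟨ 0 , 5 , 6 ⟩ ∷ ⟨ 1 , 3 , 8 ⟩ ∷ ⟨ 1 , 4 , 6 ⟩ ∷
  ⟨ 1 , 5 , 7 ⟩ ∷ ⟨ 2 , 3 , 6 ⟩ ∷ ⟨ 2 , 4 , 7 ⟩ ∷ ⟨ 2 , 5 , 8 ⟩ ∷ []
trade₉ (suc (suc zero)) =
  ⟨ 0 , 3 , 8 ⟩ ∷ ⟨ 0 , 4 , 6 ⟩ ∷ ⟨ 0 , 5 , 7 ⟩ ∷ ⟨ 1 , 3 , 6 ⟩ ∷ ⟨ 1 , 4 , 7 ⟩ ∷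
  ⟨ 1 , 5 , 8 ⟩ ∷ ⟨ 2 , 3 , 7 ⟩ ∷ ⟨ 2 , 4 , 8 ⟩ ∷ ⟨ 2 , 5 , 6 ⟩ ∷ []

trade₁₀ : Fin 3 → List (Subset 8)
trade₁₀ zero =
  ⟨ 2 , 3 , 6 ⟩ ∷ ⟨ 0 , 5 , 7 ⟩ ∷ ⟨ 0 , 3 , 4 ⟩ ∷ ⟨ 1 , 3 , 5 ⟩ ∷ ⟨ 1 , 4 , 7 ⟩ ∷
  ⟨ 0 , 1 , 6 ⟩ ∷ ⟨ 1 , 2 , 5 ⟩ ∷ ⟨ 2 , 3 , 7 ⟩ ∷ ⟨ 0 , 2 , 4 ⟩ ∷ ⟨ 4 , 5 , 6 ⟩ ∷ []
trade₁₀ (suc zero) =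
  ⟨ 0 , 3 , 6 ⟩ ∷ ⟨ 2 , 4 , 6 ⟩ ∷ ⟨ 2 , 3 , 5 ⟩ ∷ ⟨ 3 , 4 , 7 ⟩ ∷ ⟨ 1 , 5 , 7 ⟩ ∷
  ⟨ 1 , 2 , 3 ⟩ ∷ ⟨ 0 , 4 , 5 ⟩ ∷ ⟨ 0 , 2 , 7 ⟩ ∷ ⟨ 0 , 1 , 4 ⟩ ∷ ⟨ 1 , 5 , 6 ⟩ ∷ []
trade₁₀ (suc (suc zero)) =
  ⟨ 2 , 3 , 4 ⟩ ∷ ⟨ 1 , 2 , 7 ⟩ ∷ ⟨ 0 , 4 , 6 ⟩ ∷ ⟨ 0 , 2 , 3 ⟩ ∷ ⟨ 3 , 5 , 7 ⟩ ∷
  ⟨ 1 , 4 , 5 ⟩ ∷ ⟨ 0 , 4 , 7 ⟩ ∷ ⟨ 0 , 1 , 5 ⟩ ∷ ⟨ 1 , 3 , 6 ⟩ ∷ ⟨ 2 , 5 , 6 ⟩ ∷ []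

trade₁₁ : Fin 3 → List (Subset 9)
trade₁₁ zero =
  ⟨ 2 , 3 , 4 ⟩ ∷ ⟨ 0 , 1 , 4 ⟩ ∷ ⟨ 1 , 2 , 7 ⟩ ∷ ⟨ 0 , 3 , 6 ⟩ ∷ ⟨ 4 , 6 , 7 ⟩ ∷
  ⟨ 2 , 6 , 8 ⟩ ∷ ⟨ 4 , 5 , 8 ⟩ ∷ ⟨ 1 , 3 , 8 ⟩ ∷ ⟨ 1 , 5 , 6 ⟩ ∷ ⟨ 0 , 7 , 8 ⟩ ∷
  ⟨ 0 , 2 , 5 ⟩ ∷ []
trade₁₁ (suc zero) =
  ⟨ 0 , 1 , 7 ⟩ ∷ ⟨ 1 , 3 , 6 ⟩ ∷ ⟨ 3 , 4 , 8 ⟩ ∷ ⟨ 2 , 4 , 7 ⟩ ∷ ⟨ 0 , 5 , 8 ⟩ ∷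
  ⟨ 1 , 4 , 5 ⟩ ∷ ⟨ 1 , 2 , 8 ⟩ ∷ ⟨ 0 , 4 , 6 ⟩ ∷ ⟨ 6 , 7 , 8 ⟩ ∷ ⟨ 2 , 5 , 6 ⟩ ∷
  ⟨ 0 , 2 , 3 ⟩ ∷ []
trade₁₁ (suc (suc zero)) =
  ⟨ 1 , 6 , 7 ⟩ ∷ ⟨ 0 , 5 , 6 ⟩ ∷ ⟨ 2 , 4 , 5 ⟩ ∷ ⟨ 0 , 4 , 7 ⟩ ∷ ⟨ 0 , 3 , 8 ⟩ ∷
  ⟨ 2 , 7 , 8 ⟩ ∷ ⟨ 1 , 5 , 8 ⟩ ∷ ⟨ 4 , 6 , 8 ⟩ ∷ ⟨ 1 , 3 , 4 ⟩ ∷ ⟨ 0 , 1 , 2 ⟩ ∷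
  ⟨ 2 , 3 , 6 ⟩ ∷ []

trade₁₃ : Fin 3 → List (Subset 9)
trade₁₃ zero =
  ⟨ 0 , 2 , 7 ⟩ ∷ ⟨ 1 , 2 , 6 ⟩ ∷ ⟨ 0 , 1 , 6 ⟩ ∷ ⟨ 4 , 7 , 8 ⟩ ∷ ⟨ 1 , 2 , 8 ⟩ ∷
  ⟨ 2 , 5 , 8 ⟩ ∷ ⟨ 3 , 6 , 8 ⟩ ∷ ⟨ 0 , 4 , 8 ⟩ ∷ ⟨ 1 , 3 , 7 ⟩ ∷ ⟨ 1 , 4 , 5 ⟩ ∷
  ⟨ 2 , 3 , 4 ⟩ ∷ ⟨ 5 , 6 , 7 ⟩ ∷ ⟨ 0 , 3 , 5 ⟩ ∷ []
trade₁₃ (suc zero) =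
  ⟨ 3 , 5 , 7 ⟩ ∷ ⟨ 0 , 1 , 5 ⟩ ∷ ⟨ 1 , 2 , 3 ⟩ ∷ ⟨ 2 , 7 , 8 ⟩ ∷ ⟨ 0 , 4 , 7 ⟩ ∷
  ⟨ 1 , 6 , 7 ⟩ ∷ ⟨ 3 , 4 , 8 ⟩ ∷ ⟨ 4 , 5 , 8 ⟩ ∷ ⟨ 0 , 2 , 8 ⟩ ∷ ⟨ 2 , 5 , 6 ⟩ ∷
  ⟨ 1 , 2 , 4 ⟩ ∷ ⟨ 0 , 3 , 6 ⟩ ∷ ⟨ 1 , 6 , 8 ⟩ ∷ []
trade₁₃ (suc (suc zero)) =
  ⟨ 0 , 3 , 4 ⟩ ∷ ⟨ 1 , 3 , 6 ⟩ ∷ ⟨ 1 , 4 , 8 ⟩ ∷ ⟨ 1 , 2 , 7 ⟩ ∷ ⟨ 4 , 5 , 7 ⟩ ∷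
  ⟨ 0 , 1 , 2 ⟩ ∷ ⟨ 2 , 3 , 5 ⟩ ∷ ⟨ 2 , 6 , 8 ⟩ ∷ ⟨ 3 , 7 , 8 ⟩ ∷ ⟨ 1 , 5 , 6 ⟩ ∷
  ⟨ 0 , 6 , 7 ⟩ ∷ ⟨ 0 , 5 , 8 ⟩ ∷ ⟨ 2 , 4 , 8 ⟩ ∷ []
volume₆ : HasTrade≤ 3 2 3 6
volume₆ = 7 , from-yes (3 ℕ.<? 7) , trade₆ , from-yes (isTrade≤? 3 2 6 trade₆)

volume₈ : HasTrade≤ 3 2 3 8
volume₈ = 8 , from-yes (3 ℕ.<? 8) , trade₈ , from-yes (isTrade≤? 3 2 8 trade₈)

volume₉ : HasTrade≤ 3 2 3 9
volume₉ = 9 , from-yes (3 ℕ.<? 9) , trade₉ , from-yes (isTrade≤? 3 2 9 trade₉)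

volume₁₀ : HasTrade≤ 3 2 3 10
volume₁₀ = 8 , from-yes (3 ℕ.<? 8) , trade₁₀ , from-yes (isTrade≤? 3 2 10 trade₁₀)

volume₁₁ : HasTrade≤ 3 2 3 11
volume₁₁ = 9 , from-yes (3 ℕ.<? 9) , trade₁₁ , from-yes (isTrade≤? 3 2 11 trade₁₁)

volume₁₃ : HasTrade≤ 3 2 3 13
volume₁₃ = 9 , from-yes (3 ℕ.<? 9) , trade₁₃ , from-yes (isTrade≤? 3 2 13 trade₁₃)

HasTrade≤-3-2-3 : ∀ n → 6 + n ≢ 7 → HasTrade≤ 3 2 3 (6 + n)
HasTrade≤-3-2-3 0 _   = volume₆
HasTrade≤-3-2-3 1 6≢7 = ⊥-elim (6≢7 refl)
HasTrade≤-3-2-3 2 _   = volume₈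
HasTrade≤-3-2-3 3 _   = volume₉
HasTrade≤-3-2-3 4 _   = volume₁₀
HasTrade≤-3-2-3 5 _   = volume₁₁
HasTrade≤-3-2-3 6 _   = HasTrade≤-+ volume₆ volume₆
HasTrade≤-3-2-3 7 _   = volume₁₃
HasTrade≤-3-2-3 (suc (suc (suc (suc (suc (suc (suc (suc n)))))))) _ =
  HasTrade≤-+ volume₆ (HasTrade≤-3-2-3 (suc (suc n)) λ ())

theorem4p3 : ∀ (k : ℕ) → 3 ≤ k → ∀ (m : ℕ) → 6 ≤ m → m ≢ 7 → InS 3 2 k m
theorem4p3 k 3≤k m 6≤m m≢7 with m≤n⇒∃[o]m+o≡n 3≤k | m≤n⇒∃[o]m+o≡n 6≤m
... | j , refl | n , refl = HasTrade≤⇒InS (s≤s (s≤s (s≤s z≤n))) j (HasTrade≤-3-2-3 n m≢7)
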